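{- Let $I$ be an input with no duplicate elements. Every run written by the greedy algorithm (buffer size $M$) on $I$, except the last two runs, has length at least $M+\lceil\lfloor M/2\rfloor/2\rceil$.
   Context: Up-down run generation problem: an input stream $I$ of $N$ elements from a totally ordered set is presented in order to an algorithm with a buffer of $M$ slots; the algorithm reads elements in order into the buffer and writes elements from the buffer to an output sequence, each write freeing a slot that is filled by the next input element. A run is a sorted or reverse-sorted sequence. A maximal increasing run is written as follows: start with the smallest element in the buffer, always write the smallest buffered element larger than the last element written, and end the run only when every buffered element is smaller than the last element written; a maximal decreasing run is symmetric. A decision point is the start or any time a run has just ended. The greedy algorithm is the (offline) algorithm that, at each decision point, determines the lengths of the maximal increasing run and the maximal decreasing run that could be written next and writes the longer one (ties broken arbitrarily). -}

module Defs where

open import Data.Nat using (ℕ; zero; suc; _+_; _⊓_; _⊔_; _<ᵇ_; _≤_)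
open import Data.Bool using (Bool; true; false; if_then_else_)
open import Data.Maybe using (Maybe; just; nothing; maybe)
open import Data.List using (List; []; _∷_; length)
open import Data.Product using (_×_; _,_; proj₁; proj₂)

-- Elements of the totally ordered set are modelled by natural numbers
-- (only comparisons matter, and any finite input is order-isomorphic to
-- a list of naturals).

record State : Set where
  constructor ⟨_∣_⟩
  field
    buf : List ℕ
    inp : List ℕ
open State public

initState : ℕ → List ℕ → State
initState M I = ⟨ Data.List.take M I ∣ Data.List.drop M I ⟩

removeElt : ℕ → List ℕ → List ℕ
removeElt x [] = []
removeElt x (y ∷ ys) = if (x Data.Nat.≡ᵇ y) then ys else y ∷ removeElt x ys

write : ℕ → State → State
write x ⟨ b ∣ [] ⟩ = ⟨ removeElt x b ∣ [] ⟩
write x ⟨ b ∣ y ∷ ys ⟩ = ⟨ y ∷ removeElt x b ∣ ys ⟩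

-- Is x strictly above / below the optional bound (nothing = no bound,
-- used for the first element of a run)?
above : Maybe ℕ → ℕ → Bool
above nothing x = true
above (just l) x = l <ᵇ x

below : Maybe ℕ → ℕ → Bool
below nothing x = true
below (just l) x = x <ᵇ l

minAbove : Maybe ℕ → List ℕ → Maybe ℕ
minAbove b [] = nothing
minAbove b (x ∷ xs) =
  if above b x then just (maybe (λ y → x ⊓ y) x (minAbove b xs)) else minAbove b xs

maxBelow : Maybe ℕ → List ℕ → Maybe ℕ
maxBelow b [] = nothing
maxBelow b (x ∷ xs) =
  if below b x then just (maybe (λ y → x ⊔ y) x (maxBelow b xs)) else maxBelow b xs

-- Maximal increasing run (with fuel; fuel = number of elements still in
-- buffer + input suffices since each write consumes one element).
-- Returns the written run and the state after it.
upRunF : ℕ → Maybe ℕ → State → List ℕ × State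
upRunF zero b s = [] , s
upRunF (suc f) b s with minAbove b (buf s)
... | nothing = [] , s
... | just x with upRunF f (just x) (write x s)
...   | r , s' = x ∷ r , s'

downRunF : ℕ → Maybe ℕ → State → List ℕ × State
downRunF zero b s = [] , s
downRunF (suc f) b s with maxBelow b (buf s)
... | nothing = [] , s
... | just x with downRunF f (just x) (write x s)
...   | r , s' = x ∷ r , s'

size : State → ℕ
size s = length (buf s) + length (inp s)

upRun : State → List ℕ × State
upRun s = upRunF (size s) nothing s

downRun : State → List ℕ × State
downRun s = downRunF (size s) nothing s

-- GreedyRuns s rs : rs is a possible sequence of runs written by the greedy
-- algorithm started at decision point s (ties broken arbitrarily: both
-- choices are allowed when the lengths are equal).
data GreedyRuns : State → List (List ℕ) → Set where
  finished : ∀ {i} → GreedyRuns ⟨ [] ∣ i ⟩ []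
  chooseUp : ∀ {x b i rs} → let s = ⟨ x ∷ b ∣ i ⟩ in
    length (proj₁ (downRun s)) ≤ length (proj₁ (upRun s)) →
    GreedyRuns (proj₂ (upRun s)) rs →
    GreedyRuns s (proj₁ (upRun s) ∷ rs)
  chooseDown : ∀ {x b i rs} → let s = ⟨ x ∷ b ∣ i ⟩ in
    length (proj₁ (upRun s)) ≤ length (proj₁ (downRun s)) →
    GreedyRuns (proj₂ (downRun s)) rs →
    GreedyRuns s (proj₁ (downRun s) ∷ rs)

{-# OPTIONS --safe #-}
module Submission where

-- At a decision point with a full buffer B (|B| = M), let y₁, y₂, … be the
-- unread elements. The increasing run writes all of B, and also y_t as soon
-- as at least t elements of B lie below y_t: after t writes the last element
-- written is still below y_t when it arrives. Symmetrically for the decreasing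
-- run. Since y_t ∉ B, at least ⌊M/2⌋ elements of B lie below or above it, so
-- each of y₁ … y_⌊M/2⌋ is caught by one of the two runs and their lengths sum
-- to at least 2M + ⌊M/2⌋; the greedy run, being the longer one, has length at
-- least M + ⌈⌊M/2⌋/2⌉. Finally, a run that is not among the last two starts
-- with a full buffer and at least M unread elements, as every run has length
-- at least M and the buffer stays full until the input is exhausted.

open import Defs
open import Data.Nat using (ℕ; zero; suc; _+_; _∸_; _≤_; _<_; _⊓_; _⊔_; _<ᵇ_; _≤ᵇ_; _≡ᵇ_; z≤n; s≤s; ⌊_/2⌋; ⌈_/2⌉)
open import Data.Nat.Properties
open import Data.Bool using (Bool; true; false; T; _∧_; if_then_else_)
open import Data.Bool.Properties using (T-∧)
open import Data.Unit using (tt)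
open import Data.Maybe using (Maybe; just; nothing; maybe)
open import Data.List using (List; []; _∷_; length; lookup; take; drop)
open import Data.List.Properties using (length-take)
open import Data.List.Membership.Propositional using (_∈_; _∉_)
open import Data.List.Relation.Unary.Any using (here; there)
open import Data.List.Relation.Unary.All as All using (All; []; _∷_)
import Data.List.Relation.Unary.All.Properties as All
open import Data.List.Relation.Unary.AllPairs using ([]; _∷_)
open import Data.List.Relation.Unary.Unique.Propositional using (Unique)
open import Data.List.Relation.Unary.Unique.Propositional.Properties using (take⁺; drop⁺)
open import Data.List.Relation.Binary.Disjoint.Propositional using (Disjoint)
open import Data.Product using (Σ; ∃-syntax; _×_; _,_; proj₁; proj₂)
open import Data.Sum as Sum using (_⊎_; inj₁; inj₂)
open import Data.Empty using (⊥-elim)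
open import Data.Fin as Fin using (Fin; toℕ)
open import Function using (_∘_)
open import Function.Bundles using (Equivalence)
open import Relation.Nullary using (¬_; yes; no; contradiction)
open import Relation.Binary.Definitions using (Trichotomous; tri<; tri≈; tri>)
open import Relation.Binary.PropositionalEquality
open import Algebra.Definitions {A = ℕ} _≡_ using (Selective)
open import Algebra.Properties.CommutativeSemigroup +-commutativeSemigroup using (interchange; x∙yz≈y∙xz)

𝟙 : Bool → ℕ
𝟙 true  = 1
𝟙 false = 0

𝟙-mono : ∀ {a b} → (T a → T b) → 𝟙 a ≤ 𝟙 b
𝟙-mono {false}         _   = z≤n
𝟙-mono {true}  {true}  _   = ≤-refl
𝟙-mono {true}  {false} a⇒b = ⊥-elim (a⇒b tt)

𝟙≤1 : ∀ a → 𝟙 a ≤ 1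
𝟙≤1 true  = ≤-refl
𝟙≤1 false = z≤n

𝟙-⊎ : ∀ {a b} → T a ⊎ T b → 1 ≤ 𝟙 a + 𝟙 b
𝟙-⊎ {true}          _        = s≤s z≤n
𝟙-⊎ {false} {true}  _        = s≤s z≤n
𝟙-⊎ {false} {false} (inj₁ ())
𝟙-⊎ {false} {false} (inj₂ ())

T-∧-monoˡ : ∀ {a b} c → (T a → T b) → T (a ∧ c) → T (b ∧ c)
T-∧-monoˡ {true}  {true}  c _   t = t
T-∧-monoˡ {true}  {false} c a⇒b _ = ⊥-elim (a⇒b tt)

countᵇ : {A : Set} → (A → Bool) → List A → ℕ
countᵇ p []       = 0
countᵇ p (x ∷ xs) = 𝟙 (p x) + countᵇ p xs

module _ {A : Set} where

  countᵇ-true : (xs : List A) → countᵇ (λ _ → true) xs ≡ length xs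
  countᵇ-true []       = refl
  countᵇ-true (x ∷ xs) = cong suc (countᵇ-true xs)

  countᵇ-mono : ∀ {p q} (xs : List A) → (∀ {x} → x ∈ xs → T (p x) → T (q x)) →
                countᵇ p xs ≤ countᵇ q xs
  countᵇ-mono []       _   = z≤n
  countᵇ-mono (x ∷ xs) p⇒q = +-mono-≤ (𝟙-mono (p⇒q (here refl))) (countᵇ-mono xs (p⇒q ∘ there))

  countᵇ-none : ∀ {p} (xs : List A) → (∀ {x} → x ∈ xs → ¬ T (p x)) → countᵇ p xs ≡ 0
  countᵇ-none          []       _    = refl
  countᵇ-none {p = p} (x ∷ xs) none with p x | none (here refl)
  ... | false | _     = countᵇ-none xs (none ∘ there)
  ... | true  | ¬px   = ⊥-elim (¬px tt)

  countᵇ-witness : ∀ {p} (xs : List A) → 0 < countᵇ p xs → ∃[ x ] x ∈ xs × T (p x)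
  countᵇ-witness {p = p} (x ∷ xs) pos with p x in px
  ... | true  = x , here refl , subst T (sym px) tt
  ... | false with countᵇ-witness xs pos
  ...   | y , y∈xs , py = y , there y∈xs , py

  countᵇ-cover : ∀ {p q} {xs : List A} → All (λ x → T (p x) ⊎ T (q x)) xs →
                 length xs ≤ countᵇ p xs + countᵇ q xs
  countᵇ-cover          []                   = z≤n
  countᵇ-cover {p} {q} {x ∷ xs} (px⊎qx ∷ cover) = begin
    1 + length xs                                      ≤⟨ +-mono-≤ (𝟙-⊎ px⊎qx) (countᵇ-cover cover) ⟩
    (𝟙 (p x) + 𝟙 (q x)) + (countᵇ p xs + countᵇ q xs)  ≡⟨ interchange (𝟙 (p x)) _ (countᵇ p xs) _ ⟩
    countᵇ p (x ∷ xs) + countᵇ q (x ∷ xs)              ∎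
    where open ≤-Reasoning

∈-removeElt⁻ : ∀ {x z} xs → z ∈ removeElt x xs → z ∈ xs
∈-removeElt⁻ {x} (y ∷ ys) z∈ with x ≡ᵇ y
... | true  = there z∈
∈-removeElt⁻ {x} (y ∷ ys) (here z≡y)  | false = here z≡y
∈-removeElt⁻ {x} (y ∷ ys) (there z∈) | false = there (∈-removeElt⁻ ys z∈)

length-removeElt : ∀ {x} xs → x ∈ xs → suc (length (removeElt x xs)) ≡ length xs
length-removeElt {x} (y ∷ ys) x∈ with x ≡ᵇ y in x≡ᵇy
... | true = refl
length-removeElt {x} (y ∷ ys) (here refl) | false = contradiction (subst T x≡ᵇy (≡⇒≡ᵇ x x refl)) λ ()
length-removeElt {x} (y ∷ ys) (there x∈) | false = cong suc (length-removeElt ys x∈)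

unique-removeElt : ∀ {x} xs → Unique xs → Unique (removeElt x xs)
unique-removeElt []       u = u
unique-removeElt {x} (y ∷ ys) (y∉ys ∷ u) with x ≡ᵇ y
... | true  = u
... | false = All.tabulate (All.lookup y∉ys ∘ ∈-removeElt⁻ ys) ∷ unique-removeElt ys u

∈-removeElt⇒≢ : ∀ {x z} xs → Unique xs → z ∈ removeElt x xs → z ≢ x
∈-removeElt⇒≢ {x} (y ∷ ys) (y∉ys ∷ u) z∈ with x ≡ᵇ y in x≡ᵇy
... | true with ≡ᵇ⇒≡ x y (subst T (sym x≡ᵇy) tt)
...   | refl = λ z≡x → All.lookup y∉ys z∈ (sym z≡x)
∈-removeElt⇒≢ {x} (y ∷ ys) _          (here refl) | false =
  λ z≡x → contradiction (subst T x≡ᵇy (≡⇒≡ᵇ x _ (sym z≡x))) λ ()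
∈-removeElt⇒≢ {x} (y ∷ ys) (_ ∷ u)    (there z∈)  | false = ∈-removeElt⇒≢ ys u z∈

countᵇ-removeElt : ∀ p x (xs : List ℕ) → countᵇ p xs ≤ suc (countᵇ p (removeElt x xs))
countᵇ-removeElt p x []       = z≤n
countᵇ-removeElt p x (y ∷ ys) with x ≡ᵇ y
... | true  = +-monoˡ-≤ (countᵇ p ys) (𝟙≤1 (p y))
... | false = subst (countᵇ p (y ∷ ys) ≤_) (+-suc (𝟙 (p y)) _) (+-monoʳ-≤ (𝟙 (p y)) (countᵇ-removeElt p x ys))

countᵇ-write : ∀ p x s → countᵇ p (removeElt x (buf s)) ≤ countᵇ p (buf (write x s))
countᵇ-write p x ⟨ B ∣ [] ⟩    = ≤-refl
countᵇ-write p x ⟨ B ∣ y ∷ _ ⟩ = m≤n+m _ (𝟙 (p y))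

Distinct : State → Set
Distinct s = Unique (buf s) × Unique (inp s) × Disjoint (buf s) (inp s)

Invariant : ℕ → State → Set
Invariant M s = Distinct s × (inp s ≡ [] ⊎ length (buf s) ≡ M)

size-write : ∀ {x} s → x ∈ buf s → suc (size (write x s)) ≡ size s
size-write ⟨ B ∣ [] ⟩     x∈ = cong (_+ 0) (length-removeElt B x∈)
size-write ⟨ B ∣ y ∷ ys ⟩ x∈ = begin
  suc (suc (length (removeElt _ B)) + length ys) ≡⟨ cong (λ n → suc (n + length ys)) (length-removeElt B x∈) ⟩
  suc (length B + length ys)                       ≡⟨ +-suc (length B) (length ys) ⟨
  length B + suc (length ys)                       ∎
  where open ≡-Reasoning

distinct-write : ∀ {x} s → Distinct s → Distinct (write x s)
distinct-write ⟨ B ∣ [] ⟩ (uB , _ , _) = unique-removeElt B uB , [] , λ ()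
distinct-write {x} ⟨ B ∣ y ∷ ys ⟩ (uB , y∉ys ∷ uI , B∩I) =
  All.tabulate (λ z∈ y≡z → B∩I (∈-removeElt⁻ B z∈ , here (sym y≡z))) ∷ unique-removeElt B uB , uI , disjoint
  where
  disjoint : Disjoint (y ∷ removeElt x B) ys
  disjoint (here refl , y∈ys) = All.lookup y∉ys y∈ys refl
  disjoint (there z∈ , z∈ys)  = B∩I (∈-removeElt⁻ B z∈ , there z∈ys)

invariant-write : ∀ {M x} s → x ∈ buf s → Invariant M s → Invariant M (write x s)
invariant-write ⟨ B ∣ [] ⟩     x∈ (dist , _)        = distinct-write ⟨ B ∣ [] ⟩ dist , inj₁ refl
invariant-write ⟨ B ∣ y ∷ ys ⟩ x∈ (dist , inj₂ full) =
  distinct-write ⟨ B ∣ y ∷ ys ⟩ dist , inj₂ (trans (length-removeElt B x∈) full)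

invariant-init : ∀ M I → Unique I → Invariant M (initState M I)
invariant-init M I u = (take⁺ M u , drop⁺ M u , disjoint M I u) , full M I
  where
  drop⊆ : ∀ {z} n (xs : List ℕ) → z ∈ drop n xs → z ∈ xs
  drop⊆ zero    xs       z∈ = z∈
  drop⊆ (suc n) (x ∷ xs) z∈ = there (drop⊆ n xs z∈)
  disjoint : ∀ n (xs : List ℕ) → Unique xs → Disjoint (take n xs) (drop n xs)
  disjoint (suc n) (x ∷ xs) (x∉xs ∷ u) (here refl , z∈) = All.lookup x∉xs (drop⊆ n xs z∈) refl
  disjoint (suc n) (x ∷ xs) (_ ∷ u)    (there z∈ , z∈′) = disjoint n xs u (z∈ , z∈′)
  full : ∀ n (xs : List ℕ) → drop n xs ≡ [] ⊎ length (take n xs) ≡ n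
  full zero    xs       = inj₂ refl
  full (suc n) []       = inj₁ refl
  full (suc n) (x ∷ xs) with full n xs
  ... | inj₁ empty = inj₁ empty
  ... | inj₂ len   = inj₂ (cong suc len)

-- `least` and `runF` are `minAbove` and `upRunF` for an arbitrary strict total
-- order _≺_, with _∙_ selecting the ≺-smaller argument; instantiating with
-- (_<ᵇ_, _⊓_) and with the reverse order and _⊔_ gives both kinds of runs.
module MaximalRun
  (_≺_     : ℕ → ℕ → Bool)
  (≺-trans : ∀ {a b c} → T (a ≺ b) → T (b ≺ c) → T (a ≺ c))
  (≺-cmp   : Trichotomous _≡_ (λ a b → T (a ≺ b)))
  (_∙_     : ℕ → ℕ → ℕ)
  (∙-sel   : Selective _∙_)
  (∙-≼ˡ    : ∀ a b → ¬ T (a ≺ (a ∙ b)))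
  (∙-≼ʳ    : ∀ a b → ¬ T (b ≺ (a ∙ b)))
  where

  ≺-irrefl : ∀ {a} → ¬ T (a ≺ a)
  ≺-irrefl {a} a≺a with ≺-cmp a a
  ... | tri< _ _ a⊀a = a⊀a a≺a
  ... | tri≈ a⊀a _ _ = a⊀a a≺a
  ... | tri> a⊀a _ _ = a⊀a a≺a

  ≺-connex : ∀ {a b} → a ≢ b → ¬ T (a ≺ b) → T (b ≺ a)
  ≺-connex {a} {b} a≢b a⊀b with ≺-cmp a b
  ... | tri< a≺b _ _ = contradiction a≺b a⊀b
  ... | tri≈ _ a≡b _ = contradiction a≡b a≢b
  ... | tri> _ _ b≺a = b≺a

  ⊀-trans : ∀ {a b c} → ¬ T (a ≺ b) → ¬ T (b ≺ c) → ¬ T (a ≺ c)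
  ⊀-trans {a} {b} {c} a⊀b b⊀c a≺c with ≺-cmp b c
  ... | tri< b≺c _ _    = b⊀c b≺c
  ... | tri≈ _ refl _   = a⊀b a≺c
  ... | tri> _ _ c≺b    = a⊀b (≺-trans a≺c c≺b)

  eligible : Maybe ℕ → ℕ → Bool
  eligible nothing  _ = true
  eligible (just l) b = l ≺ b

  least : Maybe ℕ → List ℕ → Maybe ℕ
  least ℓ []       = nothing
  least ℓ (x ∷ xs) = if eligible ℓ x then just (maybe (x ∙_) x (least ℓ xs)) else least ℓ xs

  ∙-preserves : ∀ (P : ℕ → Set) {a b} → P a → P b → P (a ∙ b)
  ∙-preserves P {a} {b} pa pb with ∙-sel a b
  ... | inj₁ a∙b≡a = subst P (sym a∙b≡a) pa
  ... | inj₂ a∙b≡b = subst P (sym a∙b≡b) pb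

  record IsLeast (ℓ : Maybe ℕ) (B : List ℕ) (x : ℕ) : Set where
    field
      member     : x ∈ B
      isEligible : T (eligible ℓ x)
      minimal    : ∀ {b} → b ∈ B → T (eligible ℓ b) → ¬ T (b ≺ x)

  least-nothing : ∀ {ℓ B b} → least ℓ B ≡ nothing → b ∈ B → ¬ T (eligible ℓ b)
  least-nothing {ℓ} {x ∷ xs} none b∈ with eligible ℓ x in ex
  least-nothing {ℓ} {x ∷ xs} ()   b∈          | true
  least-nothing {ℓ} {x ∷ xs} none (here refl) | false = subst T ex
  least-nothing {ℓ} {x ∷ xs} none (there b∈)  | false = least-nothing none b∈

  least-just : ∀ {ℓ B x} → least ℓ B ≡ just x → IsLeast ℓ B x
  least-just {ℓ} {y ∷ ys} found with eligible ℓ y in ey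
  least-just {ℓ} {y ∷ ys} found | false = record
    { member     = there member
    ; isEligible = isEligible
    ; minimal    = λ { (here refl) ey′ → contradiction (subst T ey ey′) λ ()
                     ; (there b∈)      → minimal b∈ }
    }
    where open IsLeast (least-just {ℓ} {ys} found)
  least-just {ℓ} {y ∷ ys} found | true with least ℓ ys in eys
  least-just {ℓ} {y ∷ ys} refl  | true | nothing = record
    { member     = here refl
    ; isEligible = subst T (sym ey) tt
    ; minimal    = λ { (here refl) _ → ≺-irrefl
                     ; (there b∈) e  → contradiction e (least-nothing eys b∈) }
    }
  least-just {ℓ} {y ∷ ys} refl  | true | just z = record
    { member     = ∙-preserves (_∈ y ∷ ys) (here refl) (there member)
    ; isEligible = ∙-preserves (T ∘ eligible ℓ) (subst T (sym ey) tt) isEligible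
    ; minimal    = λ { (here refl) _ → ∙-≼ˡ y z
                     ; (there b∈) e  → ⊀-trans (minimal b∈ e) (∙-≼ʳ y z) }
    }
    where open IsLeast (least-just {ℓ} {ys} eys)

  runF : ℕ → Maybe ℕ → State → List ℕ × State
  runF zero    ℓ s = [] , s
  runF (suc f) ℓ s with least ℓ (buf s)
  ... | nothing = [] , s
  ... | just x with runF f (just x) (write x s)
  ...   | r , s′ = x ∷ r , s′

  size-runF : ∀ f ℓ s → size (proj₂ (runF f ℓ s)) + length (proj₁ (runF f ℓ s)) ≡ size s
  size-runF zero    ℓ s = +-identityʳ (size s)
  size-runF (suc f) ℓ s with least ℓ (buf s) in found
  ... | nothing = +-identityʳ (size s)
  ... | just x  = trans (+-suc _ _) (trans (cong suc (size-runF f (just x) (write x s)))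
                                           (size-write s (IsLeast.member (least-just found))))

  invariant-runF : ∀ {M} f ℓ s → Invariant M s → Invariant M (proj₂ (runF f ℓ s))
  invariant-runF zero    ℓ s inv = inv
  invariant-runF (suc f) ℓ s inv with least ℓ (buf s) in found
  ... | nothing = inv
  ... | just x  = invariant-runF f (just x) (write x s) (invariant-write s (IsLeast.member (least-just found)) inv)

  preceding : Maybe ℕ → List ℕ → ℕ → ℕ
  preceding ℓ B y = countᵇ (λ b → eligible ℓ b ∧ b ≺ y) B

  module WriteLeast {ℓ B x} (uB : Unique B) (x-least : IsLeast ℓ B x) where
    open IsLeast x-least

    ≻-least : ∀ {b} → b ∈ B → b ≢ x → T (eligible ℓ b) → T (x ≺ b)
    ≻-least b∈ b≢x eb = ≺-connex b≢x (minimal b∈ eb)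

    ∈-removeElt⇒≻-least : ∀ {b} → b ∈ removeElt x B → T (eligible ℓ b) → T (x ≺ b)
    ∈-removeElt⇒≻-least b∈ = ≻-least (∈-removeElt⁻ B b∈) (∈-removeElt⇒≢ B uB b∈)

    eligible-removeElt : countᵇ (eligible ℓ) B ≤ suc (countᵇ (eligible (just x)) (removeElt x B))
    eligible-removeElt = ≤-trans (countᵇ-removeElt _ x B) (s≤s (countᵇ-mono _ ∈-removeElt⇒≻-least))

    preceding-removeElt : ∀ y → preceding ℓ B y ≤ suc (preceding (just x) (removeElt x B) y)
    preceding-removeElt y = ≤-trans (countᵇ-removeElt _ x B)
      (s≤s (countᵇ-mono _ λ {b} b∈ → T-∧-monoˡ (b ≺ y) (∈-removeElt⇒≻-least b∈)))

    preceded⇒≻-least : ∀ {y} → 0 < preceding ℓ B y → T (x ≺ y)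
    preceded⇒≻-least {y} pos with countᵇ-witness B pos
    ... | b , b∈ , e with Equivalence.to T-∧ e | b ≟ x
    ...   | _ , x≺y   | yes refl = x≺y
    ...   | eb , b≺y  | no b≢x   = ≺-trans (≻-least b∈ b≢x eb) b≺y

  guaranteed : Maybe ℕ → State → ℕ → ℕ
  guaranteed ℓ s t = countᵇ (eligible ℓ) (buf s)
                   + countᵇ (λ y → t ≤ᵇ preceding ℓ (buf s) y) (take t (inp s))

  guaranteed-nothing : ∀ ℓ B I t → least ℓ B ≡ nothing → guaranteed ℓ ⟨ B ∣ I ⟩ t ≡ 0
  guaranteed-nothing ℓ B I t none = cong₂ _+_ (countᵇ-none B (least-nothing none)) (unpreceded t)
    where
    preceding≡0 : ∀ y → preceding ℓ B y ≡ 0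
    preceding≡0 y = countᵇ-none B λ b∈ e → least-nothing none b∈ (proj₁ (Equivalence.to T-∧ e))
    unpreceded : ∀ t → countᵇ (λ y → t ≤ᵇ preceding ℓ B y) (take t I) ≡ 0
    unpreceded zero    = refl
    unpreceded (suc t) = countᵇ-none (take (suc t) I) λ {y} _ h →
      n≮0 (subst (t <_) (preceding≡0 y) (≤ᵇ⇒≤ (suc t) _ h))

  -- The i-th input element enters the buffer right after the i-th write. If at
  -- least t ≥ i eligible elements precede it, the bound is still below it then,
  -- so it joins the run: writing the least eligible x makes x the bound, which
  -- keeps the other eligible elements eligible and lowers each count of
  -- preceding elements by at most one.
  guaranteed≤length-runF : ∀ f ℓ s t → Distinct s → size s ≤ f →
                           guaranteed ℓ s t ≤ length (proj₁ (runF f ℓ s))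
  guaranteed≤length-runF zero    ℓ ⟨ [] ∣ I ⟩    t _ _  = ≤-reflexive (guaranteed-nothing ℓ [] I t refl)
  guaranteed≤length-runF zero    ℓ ⟨ _ ∷ _ ∣ _ ⟩ t _ ()
  guaranteed≤length-runF (suc f) ℓ ⟨ B ∣ I ⟩     t dist sz with least ℓ B in found
  ... | nothing = ≤-reflexive (guaranteed-nothing ℓ B I t found)
  ... | just x  = step I t dist sz
    where
    open IsLeast (least-just {ℓ} {B} {x} found)
    open WriteLeast {ℓ} {B} {x} (proj₁ dist) (least-just found)

    ih : ∀ {I} t → Distinct ⟨ B ∣ I ⟩ → size ⟨ B ∣ I ⟩ ≤ suc f →
         guaranteed (just x) (write x ⟨ B ∣ I ⟩) t ≤ length (proj₁ (runF f (just x) (write x ⟨ B ∣ I ⟩)))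
    ih {I} t dist sz = guaranteed≤length-runF f (just x) (write x ⟨ B ∣ I ⟩) t (distinct-write ⟨ B ∣ I ⟩ dist)
                  (≤-pred (≤-trans (≤-reflexive (size-write ⟨ B ∣ I ⟩ member)) sz))

    uncaught : ∀ I → Distinct ⟨ B ∣ I ⟩ → size ⟨ B ∣ I ⟩ ≤ suc f →
               countᵇ (eligible ℓ) B + 0 ≤ suc (length (proj₁ (runF f (just x) (write x ⟨ B ∣ I ⟩))))
    uncaught I dist sz = begin
      countᵇ (eligible ℓ) B + 0                                         ≡⟨ +-identityʳ _ ⟩
      countᵇ (eligible ℓ) B                                             ≤⟨ eligible-removeElt ⟩
      suc (countᵇ (eligible (just x)) (removeElt x B))                  ≤⟨ s≤s (countᵇ-write _ x ⟨ B ∣ I ⟩) ⟩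
      suc (countᵇ (eligible (just x)) (buf (write x ⟨ B ∣ I ⟩)))        ≤⟨ s≤s (m≤m+n _ 0) ⟩
      suc (guaranteed (just x) (write x ⟨ B ∣ I ⟩) 0)                   ≤⟨ s≤s (ih 0 dist sz) ⟩
      suc (length (proj₁ (runF f (just x) (write x ⟨ B ∣ I ⟩))))        ∎
      where open ≤-Reasoning

    step : ∀ I t → Distinct ⟨ B ∣ I ⟩ → size ⟨ B ∣ I ⟩ ≤ suc f →
           guaranteed ℓ ⟨ B ∣ I ⟩ t ≤ suc (length (proj₁ (runF f (just x) (write x ⟨ B ∣ I ⟩))))
    step I       zero    dist sz = uncaught I dist sz
    step []      (suc t) dist sz = uncaught [] dist sz
    step (y ∷ ys) (suc t) dist sz = begin
      countᵇ (eligible ℓ) B + (𝟙 (suc t ≤ᵇ preceding ℓ B y)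
                               + countᵇ (λ v → suc t ≤ᵇ preceding ℓ B v) (take t ys))
        ≤⟨ +-mono-≤ eligible-removeElt (+-mono-≤ (𝟙-mono y-caught) (countᵇ-mono (take t ys) λ _ → shift)) ⟩
      suc E + (𝟙 (x ≺ y) + C)
        ≡⟨ cong suc (trans (x∙yz≈y∙xz E (𝟙 (x ≺ y)) C) (sym (+-assoc (𝟙 (x ≺ y)) E C))) ⟩
      suc ((𝟙 (x ≺ y) + E) + C)
        ≤⟨ s≤s (ih t dist sz) ⟩
      suc (length (proj₁ (runF f (just x) (write x ⟨ B ∣ y ∷ ys ⟩))))
        ∎
      where
      open ≤-Reasoning
      E = countᵇ (eligible (just x)) (removeElt x B)
      C = countᵇ (λ v → t ≤ᵇ preceding (just x) (y ∷ removeElt x B) v) (take t ys)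
      y-caught : T (suc t ≤ᵇ preceding ℓ B y) → T (x ≺ y)
      y-caught h = preceded⇒≻-least (≤-trans (s≤s z≤n) (≤ᵇ⇒≤ (suc t) _ h))
      shift : ∀ {v} → T (suc t ≤ᵇ preceding ℓ B v) → T (t ≤ᵇ preceding (just x) (y ∷ removeElt x B) v)
      shift {v} h = ≤⇒≤ᵇ (≤-pred (≤-trans (≤ᵇ⇒≤ (suc t) _ h)
                                         (≤-trans (preceding-removeElt v) (s≤s (m≤n+m _ _)))))

  run : State → List ℕ × State
  run s = runF (size s) nothing s

  size-run : ∀ s → size (proj₂ (run s)) + length (proj₁ (run s)) ≡ size s
  size-run s = size-runF (size s) nothing s

  invariant-run : ∀ {M} s → Invariant M s → Invariant M (proj₂ (run s))
  invariant-run s = invariant-runF (size s) nothing s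

  length-run≥ : ∀ s t → Distinct s →
    length (buf s) + countᵇ (λ y → t ≤ᵇ countᵇ (_≺ y) (buf s)) (take t (inp s)) ≤ length (proj₁ (run s))
  length-run≥ s t dist = begin
    length (buf s) + caught ≡⟨ cong (_+ caught) (countᵇ-true (buf s)) ⟨
    guaranteed nothing s t  ≤⟨ guaranteed≤length-runF (size s) nothing s t dist ≤-refl ⟩
    length (proj₁ (run s))  ∎
    where
    open ≤-Reasoning
    caught = countᵇ (λ y → t ≤ᵇ countᵇ (_≺ y) (buf s)) (take t (inp s))

<ᵇ-trans : ∀ {a b c} → T (a <ᵇ b) → T (b <ᵇ c) → T (a <ᵇ c)
<ᵇ-trans {a} {b} {c} a<b b<c = <⇒<ᵇ (<-trans (<ᵇ⇒< a b a<b) (<ᵇ⇒< b c b<c))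

<ᵇ-cmp : Trichotomous _≡_ (λ a b → T (a <ᵇ b))
<ᵇ-cmp a b with <-cmp a b
... | tri< a<b a≢b a≯b = tri< (<⇒<ᵇ a<b) a≢b (a≯b ∘ <ᵇ⇒< b a)
... | tri≈ a≮b a≡b a≯b = tri≈ (a≮b ∘ <ᵇ⇒< a b) a≡b (a≯b ∘ <ᵇ⇒< b a)
... | tri> a≮b a≢b a>b = tri> (a≮b ∘ <ᵇ⇒< a b) a≢b (<⇒<ᵇ a>b)

>ᵇ-cmp : Trichotomous _≡_ (λ a b → T (b <ᵇ a))
>ᵇ-cmp a b with <ᵇ-cmp b a
... | tri< b<a b≢a b≯a = tri< b<a (b≢a ∘ sym) b≯a
... | tri≈ b≮a b≡a b≯a = tri≈ b≮a (sym b≡a) b≯a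
... | tri> b≮a b≢a b>a = tri> b≮a (b≢a ∘ sym) b>a

module Up = MaximalRun _<ᵇ_ (λ {a} {b} {c} → <ᵇ-trans {a} {b} {c}) <ᵇ-cmp _⊓_ ⊓-sel
  (λ a b a<a⊓b → <⇒≱ (<ᵇ⇒< a _ a<a⊓b) (m⊓n≤m a b))
  (λ a b b<a⊓b → <⇒≱ (<ᵇ⇒< b _ b<a⊓b) (m⊓n≤n a b))

module Down = MaximalRun (λ a b → b <ᵇ a) (λ {a} {b} {c} a>b b>c → <ᵇ-trans {c} {b} {a} b>c a>b) >ᵇ-cmp _⊔_ ⊔-sel
  (λ a b a⊔b<a → <⇒≱ (<ᵇ⇒< _ a a⊔b<a) (m≤m⊔n a b))
  (λ a b a⊔b<b → <⇒≱ (<ᵇ⇒< _ b a⊔b<b) (m≤n⊔m a b))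

minAbove≡least : ∀ ℓ B → minAbove ℓ B ≡ Up.least ℓ B
minAbove≡least ℓ        []       = refl
minAbove≡least nothing  (x ∷ xs) rewrite minAbove≡least nothing xs  = refl
minAbove≡least (just l) (x ∷ xs) rewrite minAbove≡least (just l) xs = refl

maxBelow≡least : ∀ ℓ B → maxBelow ℓ B ≡ Down.least ℓ B
maxBelow≡least ℓ        []       = refl
maxBelow≡least nothing  (x ∷ xs) rewrite maxBelow≡least nothing xs  = refl
maxBelow≡least (just l) (x ∷ xs) rewrite maxBelow≡least (just l) xs = refl

upRunF≡runF : ∀ f ℓ s → upRunF f ℓ s ≡ Up.runF f ℓ s
upRunF≡runF zero    ℓ s = refl
upRunF≡runF (suc f) ℓ s rewrite minAbove≡least ℓ (buf s) with Up.least ℓ (buf s)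
... | nothing = refl
... | just x  = cong (λ (r , s′) → x ∷ r , s′) (upRunF≡runF f (just x) (write x s))

downRunF≡runF : ∀ f ℓ s → downRunF f ℓ s ≡ Down.runF f ℓ s
downRunF≡runF zero    ℓ s = refl
downRunF≡runF (suc f) ℓ s rewrite maxBelow≡least ℓ (buf s) with Down.least ℓ (buf s)
... | nothing = refl
... | just x  = cong (λ (r , s′) → x ∷ r , s′) (downRunF≡runF f (just x) (write x s))

data Direction : Set where
  up down : Direction

opposite : Direction → Direction
opposite up   = down
opposite down = up

run : Direction → State → List ℕ × State
run up   = upRun
run down = downRun

written : Direction → State → List ℕ
written d s = proj₁ (run d s)

after : Direction → State → State
after d s = proj₂ (run d s)

size-after : ∀ d s → size (after d s) + length (written d s) ≡ size s
size-after up   s rewrite upRunF≡runF   (size s) nothing s = Up.size-run s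
size-after down s rewrite downRunF≡runF (size s) nothing s = Down.size-run s

invariant-after : ∀ {M} d s → Invariant M s → Invariant M (after d s)
invariant-after up   s rewrite upRunF≡runF   (size s) nothing s = Up.invariant-run s
invariant-after down s rewrite downRunF≡runF (size s) nothing s = Down.invariant-run s

length-written-up≥ : ∀ s t → Distinct s →
  length (buf s) + countᵇ (λ y → t ≤ᵇ countᵇ (_<ᵇ y) (buf s)) (take t (inp s)) ≤ length (written up s)
length-written-up≥ s rewrite upRunF≡runF (size s) nothing s = Up.length-run≥ s

length-written-down≥ : ∀ s t → Distinct s →
  length (buf s) + countᵇ (λ y → t ≤ᵇ countᵇ (y <ᵇ_) (buf s)) (take t (inp s)) ≤ length (written down s)
length-written-down≥ s rewrite downRunF≡runF (size s) nothing s = Down.length-run≥ s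

buf≤written : ∀ d s → Distinct s → length (buf s) ≤ length (written d s)
buf≤written up   s dist = ≤-trans (m≤m+n _ _) (length-written-up≥ s 0 dist)
buf≤written down s dist = ≤-trans (m≤m+n _ _) (length-written-down≥ s 0 dist)

m+m≤n+o⇒m≤n⊎m≤o : ∀ {m n o} → m + m ≤ n + o → m ≤ n ⊎ m ≤ o
m+m≤n+o⇒m≤n⊎m≤o {m} {n} {o} le with m ≤? n | m ≤? o
... | yes m≤n | _       = inj₁ m≤n
... | no  _   | yes m≤o = inj₂ m≤o
... | no  m≰n | no  m≰o = contradiction le (<⇒≱ (+-mono-< (≰⇒> m≰n) (≰⇒> m≰o)))

⌊n/2⌋+⌊n/2⌋≤n : ∀ n → ⌊ n /2⌋ + ⌊ n /2⌋ ≤ n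
⌊n/2⌋+⌊n/2⌋≤n n = ≤-trans (+-monoʳ-≤ ⌊ n /2⌋ (⌊n/2⌋≤⌈n/2⌉ n))
                          (≤-reflexive (⌊n/2⌋+⌈n/2⌉≡n n))

⌈m+m+n/2⌉≡m+⌈n/2⌉ : ∀ m n → ⌈ m + m + n /2⌉ ≡ m + ⌈ n /2⌉
⌈m+m+n/2⌉≡m+⌈n/2⌉ zero    n = refl
⌈m+m+n/2⌉≡m+⌈n/2⌉ (suc m) n rewrite +-suc m m = cong suc (⌈m+m+n/2⌉≡m+⌈n/2⌉ m n)

m+m+n≤k+k⇒m+⌈n/2⌉≤k : ∀ m n k → m + m + n ≤ k + k → m + ⌈ n /2⌉ ≤ k
m+m+n≤k+k⇒m+⌈n/2⌉≤k m n k le = begin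
  m + ⌈ n /2⌉         ≡⟨ ⌈m+m+n/2⌉≡m+⌈n/2⌉ m n ⟨
  ⌈ m + m + n /2⌉     ≤⟨ ⌈n/2⌉-mono le ⟩
  ⌈ k + k /2⌉         ≡⟨ n≡⌈n+n/2⌉ k ⟨
  k                   ∎
  where open ≤-Reasoning

length≤below+above : ∀ {y} B → y ∉ B → length B ≤ countᵇ (_<ᵇ y) B + countᵇ (y <ᵇ_) B
length≤below+above {y} B y∉B = countᵇ-cover (All.tabulate side)
  where
  side : ∀ {b} → b ∈ B → T (b <ᵇ y) ⊎ T (y <ᵇ b)
  side {b} b∈ with <ᵇ-cmp b y
  ... | tri< b<y _ _    = inj₁ b<y
  ... | tri≈ _ refl _   = contradiction b∈ y∉B
  ... | tri> _ _ y<b    = inj₂ y<b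

written-up+down≥ : ∀ {M} s → Distinct s → length (buf s) ≡ M → ⌊ M /2⌋ ≤ length (inp s) →
  M + M + ⌊ M /2⌋ ≤ length (written up s) + length (written down s)
written-up+down≥ {M} s dist@(_ , _ , B∩I) refl h≤I = begin
  M + M + h                ≤⟨ +-monoʳ-≤ (M + M) caught ⟩
  (M + M) + (cU + cD)      ≡⟨ interchange M M cU cD ⟩
  (M + cU) + (M + cD)      ≤⟨ +-mono-≤ (length-written-up≥ s h dist) (length-written-down≥ s h dist) ⟩
  length (written up s) + length (written down s) ∎
  where
  open ≤-Reasoning
  B = buf s
  h = ⌊ M /2⌋
  first = take h (inp s)
  cU = countᵇ (λ y → h ≤ᵇ countᵇ (_<ᵇ y) B) first
  cD = countᵇ (λ y → h ≤ᵇ countᵇ (y <ᵇ_) B) first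
  caught-by-one : ∀ {y} → y ∈ inp s → T (h ≤ᵇ countᵇ (_<ᵇ y) B) ⊎ T (h ≤ᵇ countᵇ (y <ᵇ_) B)
  caught-by-one {y} y∈I = Sum.map ≤⇒≤ᵇ ≤⇒≤ᵇ (m+m≤n+o⇒m≤n⊎m≤o {h} {countᵇ (_<ᵇ y) B}
    (≤-trans (⌊n/2⌋+⌊n/2⌋≤n M) (length≤below+above B λ y∈B → B∩I (y∈B , y∈I))))
  caught : h ≤ cU + cD
  caught = begin
    h                      ≡⟨ m≤n⇒m⊓n≡m h≤I ⟨
    h ⊓ length (inp s)     ≡⟨ length-take h (inp s) ⟨
    length first           ≤⟨ countᵇ-cover (All.take⁺ h (All.tabulate caught-by-one)) ⟩
    cU + cD                ∎

written+opposite≥ : ∀ {M} d s → Distinct s → length (buf s) ≡ M → ⌊ M /2⌋ ≤ length (inp s) →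
  M + M + ⌊ M /2⌋ ≤ length (written d s) + length (written (opposite d) s)
written+opposite≥ up   s dist full h≤I = written-up+down≥ s dist full h≤I
written+opposite≥ {M} down s dist full h≤I =
  subst (M + M + ⌊ M /2⌋ ≤_) (+-comm (length (written up s)) _) (written-up+down≥ s dist full h≤I)

after-exhausted : ∀ d s → Distinct s → inp s ≡ [] → size (after d s) ≡ 0
after-exhausted d ⟨ B ∣ [] ⟩ dist refl = n≤0⇒n≡0 (+-cancelʳ-≤ (length (written d ⟨ B ∣ [] ⟩)) _ 0 (begin
  size (after d ⟨ B ∣ [] ⟩) + length (written d ⟨ B ∣ [] ⟩) ≡⟨ size-after d ⟨ B ∣ [] ⟩ ⟩
  length B + 0                                             ≡⟨ +-identityʳ (length B) ⟩
  length B                                                 ≤⟨ buf≤written d ⟨ B ∣ [] ⟩ dist ⟩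
  length (written d ⟨ B ∣ [] ⟩)                            ∎))
  where open ≤-Reasoning

greedy-head : ∀ {s r rs} → GreedyRuns s (r ∷ rs) →
  Σ Direction λ d → r ≡ written d s × length (written (opposite d) s) ≤ length r × GreedyRuns (after d s) rs
greedy-head (chooseUp   down≤up g) = up   , refl , down≤up , g
greedy-head (chooseDown up≤down g) = down , refl , up≤down , g

greedy-empty : ∀ {s rs} → size s ≡ 0 → GreedyRuns s rs → rs ≡ []
greedy-empty _  finished         = refl
greedy-empty () (chooseUp _ _)
greedy-empty () (chooseDown _ _)

greedy-exhausted : ∀ {s rs} → Distinct s → inp s ≡ [] → GreedyRuns s rs → length rs ≤ 1
greedy-exhausted {rs = []}              _    _     _ = z≤n
greedy-exhausted {s} {rs = _ ∷ _} dist empty g with greedy-head g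
... | d , _ , _ , g′ rewrite greedy-empty (after-exhausted d s dist empty) g′ = ≤-refl

greedy-input : ∀ {M s r rs} → Invariant M s → GreedyRuns s (r ∷ rs) → 2 ≤ length rs →
  length (buf s) ≡ M × M ≤ length (inp s)
greedy-input {s = s} (dist , inj₁ empty) g 2≤rs with greedy-head g
... | d , refl , _ , g′ =
  contradiction (subst ((2 ≤_) ∘ length) (greedy-empty (after-exhausted d s dist empty) g′) 2≤rs) λ ()
greedy-input {M} {s} inv@(dist , inj₂ full) g 2≤rs with greedy-head g
... | d , refl , _ , g′ = full , +-cancelˡ-≤ M M _ (begin
  M + M                           ≤⟨ +-mono-≤ M≤size′ M≤written ⟩
  size s′ + length (written d s)  ≡⟨ size-after d s ⟩
  length (buf s) + length (inp s) ≡⟨ cong (_+ length (inp s)) full ⟩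
  M + length (inp s)              ∎)
  where
  open ≤-Reasoning
  s′ = after d s
  full′ : length (buf s′) ≡ M
  full′ with invariant-after d s inv
  ... | dist′ , inj₁ empty′ = contradiction (greedy-exhausted dist′ empty′ g′) (<⇒≱ 2≤rs)
  ... | _     , inj₂ full′  = full′
  M≤size′ : M ≤ size s′
  M≤size′ = subst (_≤ size s′) full′ (m≤m+n _ _)
  M≤written : M ≤ length (written d s)
  M≤written = subst (_≤ length (written d s)) full (buf≤written d s dist)

greedy-run-long : ∀ {M s r rs} → Invariant M s → GreedyRuns s (r ∷ rs) → 2 ≤ length rs →
  M + ⌈ ⌊ M /2⌋ /2⌉ ≤ length r
greedy-run-long {M} {s} inv g 2≤rs with greedy-head g | greedy-input inv g 2≤rs
... | d , refl , opposite≤ , _ | full , M≤I = m+m+n≤k+k⇒m+⌈n/2⌉≤k M ⌊ M /2⌋ _ (begin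
  M + M + ⌊ M /2⌋
    ≤⟨ written+opposite≥ d s (proj₁ inv) full (≤-trans (⌊n/2⌋≤n M) M≤I) ⟩
  length (written d s) + length (written (opposite d) s)
    ≤⟨ +-monoʳ-≤ (length (written d s)) opposite≤ ⟩
  length (written d s) + length (written d s)
    ∎)
  where open ≤-Reasoning

greedy-runs-long : ∀ {M s rs} → Invariant M s → GreedyRuns s rs →
  (k : Fin (length rs)) → 2 + toℕ k < length rs → M + ⌈ ⌊ M /2⌋ /2⌉ ≤ length (lookup rs k)
greedy-runs-long {rs = r ∷ rs} inv g Fin.zero    k< = greedy-run-long inv g (≤-pred k<)
greedy-runs-long {s = s} {rs = r ∷ rs} inv g (Fin.suc k) k< with greedy-head g
... | d , refl , _ , g′ = greedy-runs-long (invariant-after d s inv) g′ k (≤-pred k<)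

m<n∸2⇒2+m<n : ∀ {m} n → m < n ∸ 2 → 2 + m < n
m<n∸2⇒2+m<n (suc (suc n)) m<n∸2 = s≤s (s≤s m<n∸2)

theorem6 : (M : ℕ) (I : List ℕ) → Unique I →
    (rs : List (List ℕ)) → GreedyRuns (initState M I) rs →
    (k : Fin (length rs)) → toℕ k < length rs ∸ 2 →
    M + ⌈ ⌊ M /2⌋ /2⌉ ≤ length (lookup rs k)
theorem6 M I u rs g k k< = greedy-runs-long (invariant-init M I u) g k (m<n∸2⇒2+m<n (length rs) k<)
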